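{- Let $\mathcal{C}$ be a category with finite products and weak equalisers in which every object is a choice object, and let $r=\langle r_1,r_2\rangle\colon R\to X\times X$ be any arrow. Then (1) $r$ is reflexive iff the relation $\sim_r$ is reflexive; (2) $r$ is symmetric iff $\sim_r$ is symmetric; (3) $r$ is transitive iff $\sim_r$ is transitive.
   Context: Global elements $x\colon1\to X$ are written $x\in X$; for an arrow $a\colon A\to X$, $x\in_a$ means some $u\in A$ has $au=x$; $a$ is surjective if $x\in_a$ for all $x\in X$; an object is a choice object if every surjection onto it has a section. For $r\colon R\to X\times X$, the relation $\sim_r$ on global elements of $X$ is $x\sim_r x'$ iff $\langle x,x'\rangle\in_r$. The arrow $r$ is reflexive if there is $\rho\colon X\to R$ with $r\rho=\langle1_X,1_X\rangle$; symmetric if there is $\sigma\colon R\to R$ with $r\sigma=\langle r_2,r_1\rangle$; transitive if there is $\tau\colon Q\to R$ with $r\tau=\langle r_1p_1,r_2p_2\rangle$, where $(Q,p_1,p_2)$ is a weak pullback (pullback without uniqueness of mediating arrow) of $r_2$ and $r_1$ (so $r_2p_1=r_1p_2$). -}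

module Defs where

open import Level using (Level; _⊔_; suc)
open import Relation.Binary.PropositionalEquality using (_≡_)
open import Data.Product using (Σ; Σ-syntax; _×_; _,_)
open import Function.Bundles using (_⇔_)

record Category (o ℓ : Level) : Set (suc (o ⊔ ℓ)) where
  infixr 9 _∘_
  field
    Obj  : Set o
    Hom  : Obj → Obj → Set ℓ
    id   : ∀ {A} → Hom A A
    _∘_  : ∀ {A B C} → Hom B C → Hom A B → Hom A C
    identityˡ : ∀ {A B} {f : Hom A B} → id ∘ f ≡ f
    identityʳ : ∀ {A B} {f : Hom A B} → f ∘ id ≡ f
    assoc : ∀ {A B C D} {f : Hom A B} {g : Hom B C} {h : Hom C D} →
            (h ∘ g) ∘ f ≡ h ∘ (g ∘ f)

record FiniteProducts {o ℓ} (C : Category o ℓ) : Set (o ⊔ ℓ) where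
  open Category C
  field
    ⊤ : Obj
    ! : ∀ {A} → Hom A ⊤
    !-unique : ∀ {A} (f : Hom A ⊤) → f ≡ !
    _⊗_ : Obj → Obj → Obj
    π₁ : ∀ {A B} → Hom (A ⊗ B) A
    π₂ : ∀ {A B} → Hom (A ⊗ B) B
    ⟨_,_⟩ : ∀ {A B Z} → Hom Z A → Hom Z B → Hom Z (A ⊗ B)
    π₁∘⟨⟩ : ∀ {A B Z} {f : Hom Z A} {g : Hom Z B} → π₁ ∘ ⟨ f , g ⟩ ≡ f
    π₂∘⟨⟩ : ∀ {A B Z} {f : Hom Z A} {g : Hom Z B} → π₂ ∘ ⟨ f , g ⟩ ≡ g
    ⟨⟩-unique : ∀ {A B Z} {f : Hom Z A} {g : Hom Z B} (h : Hom Z (A ⊗ B)) →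
                π₁ ∘ h ≡ f → π₂ ∘ h ≡ g → h ≡ ⟨ f , g ⟩

module _ {o ℓ} (C : Category o ℓ) where
  open Category C

  record IsWeakEqualiser {E A B : Obj} (f g : Hom A B) (e : Hom E A) : Set (o ⊔ ℓ) where
    field
      equalises : f ∘ e ≡ g ∘ e
      mediate : ∀ {T} (h : Hom T A) → f ∘ h ≡ g ∘ h → Σ[ k ∈ Hom T E ] e ∘ k ≡ h

  HasWeakEqualisers : Set (o ⊔ ℓ)
  HasWeakEqualisers = ∀ {A B} (f g : Hom A B) →
    Σ[ E ∈ Obj ] Σ[ e ∈ Hom E A ] IsWeakEqualiser f g e

  record IsWeakPullback {A B Z Q : Obj} (f : Hom A Z) (g : Hom B Z)
                        (p₁ : Hom Q A) (p₂ : Hom Q B) : Set (o ⊔ ℓ) where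
    field
      commutes : f ∘ p₁ ≡ g ∘ p₂
      mediate : ∀ {T} (q₁ : Hom T A) (q₂ : Hom T B) → f ∘ q₁ ≡ g ∘ q₂ →
                Σ[ m ∈ Hom T Q ] (p₁ ∘ m ≡ q₁ × p₂ ∘ m ≡ q₂)

  module WithProducts (P : FiniteProducts C) where
    open FiniteProducts P

    _∈[_] : ∀ {A X} → Hom ⊤ X → Hom A X → Set ℓ
    _∈[_] {A} x a = Σ[ u ∈ Hom ⊤ A ] a ∘ u ≡ x

    Surjective : ∀ {A X} → Hom A X → Set ℓ
    Surjective {X = X} a = ∀ (x : Hom ⊤ X) → x ∈[ a ]

    ChoiceObject : Obj → Set (o ⊔ ℓ)
    ChoiceObject X = ∀ {A} (a : Hom A X) → Surjective a → Σ[ s ∈ Hom X A ] a ∘ s ≡ id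

    module _ {R X : Obj} (r : Hom R (X ⊗ X)) where
      r₁ : Hom R X
      r₁ = π₁ ∘ r
      r₂ : Hom R X
      r₂ = π₂ ∘ r

      _∼_ : Hom ⊤ X → Hom ⊤ X → Set ℓ
      x ∼ x′ = ⟨ x , x′ ⟩ ∈[ r ]

      IsReflexiveArrow : Set ℓ
      IsReflexiveArrow = Σ[ ρ ∈ Hom X R ] r ∘ ρ ≡ ⟨ id , id ⟩

      IsSymmetricArrow : Set ℓ
      IsSymmetricArrow = Σ[ σ ∈ Hom R R ] r ∘ σ ≡ ⟨ r₂ , r₁ ⟩

      IsTransitiveArrow : Set (o ⊔ ℓ)
      IsTransitiveArrow =
        Σ[ Q ∈ Obj ] Σ[ p₁ ∈ Hom Q R ] Σ[ p₂ ∈ Hom Q R ]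
          (IsWeakPullback r₂ r₁ p₁ p₂ ×
           Σ[ τ ∈ Hom Q R ] r ∘ τ ≡ ⟨ r₁ ∘ p₁ , r₂ ∘ p₂ ⟩)

      RelReflexive : Set ℓ
      RelReflexive = ∀ (x : Hom ⊤ X) → x ∼ x

      RelSymmetric : Set ℓ
      RelSymmetric = ∀ (x x′ : Hom ⊤ X) → x ∼ x′ → x′ ∼ x

      RelTransitive : Set ℓ
      RelTransitive = ∀ (x x′ x″ : Hom ⊤ X) → x ∼ x′ → x′ ∼ x″ → x ∼ x″

-- Each arrow property says that a certain arrow F : Y → X × X factors
-- through r: F = ⟨1,1⟩ (Y = X) for reflexivity, F = ⟨r₂,r₁⟩ (Y = R) for
-- symmetry, and F = ⟨r₁p₁, r₂p₂⟩ (Y = Q, a weak pullback of r₂ and r₁) for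
-- transitivity.  The core lemma says that, for Y a choice object, F
-- factors through G iff every global element F ∘ y lies in the image of G:
-- the second leg of a weak pullback of G and F (built from a weak
-- equaliser) is then surjective, and a section of it yields the
-- factorisation.  Each property of ∼_r is shown to be exactly this
-- pointwise condition for the corresponding F, and the theorem follows by
-- chaining the two equivalences.

module Submission where

open import Defs
open import Data.Product using (_×_; Σ-syntax; _,_; proj₁; proj₂)
open import Function.Bundles using (_⇔_; mk⇔; module Equivalence)
open import Function.Construct.Composition using (_⇔-∘_)
open import Function.Construct.Symmetry using (⇔-sym)
open import Relation.Binary.PropositionalEquality
  using (_≡_; refl; sym; trans; cong; cong₂; module ≡-Reasoning)

module Development {o ℓ} (C : Category o ℓ) (P : FiniteProducts C) where
  open Category C
  open FiniteProducts P
  open WithProducts C P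
  open ≡-Reasoning

  ⟨⟩∘ : ∀ {A B Z W} {f : Hom Z A} {g : Hom Z B} {h : Hom W Z} →
        ⟨ f , g ⟩ ∘ h ≡ ⟨ f ∘ h , g ∘ h ⟩
  ⟨⟩∘ {h = h} = ⟨⟩-unique _
    (trans (sym assoc) (cong (_∘ h) π₁∘⟨⟩))
    (trans (sym assoc) (cong (_∘ h) π₂∘⟨⟩))

  pair-expand : ∀ {A B Z W} (h : Hom Z (A ⊗ B)) (k : Hom W Z) →
                h ∘ k ≡ ⟨ (π₁ ∘ h) ∘ k , (π₂ ∘ h) ∘ k ⟩
  pair-expand h k = ⟨⟩-unique _ (sym assoc) (sym assoc)

  π₁-of : ∀ {A B Z W} {h : Hom Z (A ⊗ B)} {k : Hom W Z} {f : Hom W A} {g : Hom W B} →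
          h ∘ k ≡ ⟨ f , g ⟩ → (π₁ ∘ h) ∘ k ≡ f
  π₁-of e = trans assoc (trans (cong (π₁ ∘_) e) π₁∘⟨⟩)

  π₂-of : ∀ {A B Z W} {h : Hom Z (A ⊗ B)} {k : Hom W Z} {f : Hom W A} {g : Hom W B} →
          h ∘ k ≡ ⟨ f , g ⟩ → (π₂ ∘ h) ∘ k ≡ g
  π₂-of e = trans assoc (trans (cong (π₂ ∘_) e) π₂∘⟨⟩)

  pairing-equalises : ∀ {A B Z T} {f : Hom A Z} {g : Hom B Z} {a : Hom T A} {b : Hom T B} →
                      f ∘ a ≡ g ∘ b → (f ∘ π₁) ∘ ⟨ a , b ⟩ ≡ (g ∘ π₂) ∘ ⟨ a , b ⟩
  pairing-equalises {f = f} {g} {a} {b} square = begin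
    (f ∘ π₁) ∘ ⟨ a , b ⟩ ≡⟨ assoc ⟩
    f ∘ (π₁ ∘ ⟨ a , b ⟩) ≡⟨ cong (f ∘_) π₁∘⟨⟩ ⟩
    f ∘ a                ≡⟨ square ⟩
    g ∘ b                ≡⟨ cong (g ∘_) (sym π₂∘⟨⟩) ⟩
    g ∘ (π₂ ∘ ⟨ a , b ⟩) ≡⟨ sym assoc ⟩
    (g ∘ π₂) ∘ ⟨ a , b ⟩ ∎

  ∈-resp : ∀ {A X} {a : Hom A X} {x y : Hom ⊤ X} → x ≡ y → x ∈[ a ] → y ∈[ a ]
  ∈-resp x≡y (u , au≡x) = u , trans au≡x x≡y

  FactorsThrough : ∀ {R Y W} → Hom Y W → Hom R W → Set ℓ
  FactorsThrough {R} {Y} F G = Σ[ k ∈ Hom Y R ] G ∘ k ≡ F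

  PointwiseIn : ∀ {R Y W} → Hom Y W → Hom R W → Set ℓ
  PointwiseIn {Y = Y} F G = ∀ (y : Hom ⊤ Y) → (F ∘ y) ∈[ G ]

  factor⇒pointwise : ∀ {R Y W} {F : Hom Y W} {G : Hom R W} →
                     FactorsThrough F G → PointwiseIn F G
  factor⇒pointwise (k , Gk≡F) y = k ∘ y , trans (sym assoc) (cong (_∘ y) Gk≡F)

  module _ (weq : HasWeakEqualisers C) where

    weakPullback : ∀ {A B Z} (f : Hom A Z) (g : Hom B Z) →
      Σ[ Q ∈ Obj ] Σ[ p₁ ∈ Hom Q A ] Σ[ p₂ ∈ Hom Q B ] IsWeakPullback C f g p₁ p₂
    weakPullback f g with weq (f ∘ π₁) (g ∘ π₂)
    ... | E , e , isWeq = E , π₁ ∘ e , π₂ ∘ e , record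
      { commutes = trans (sym assoc) (trans equalises assoc)
      ; mediate  = λ a b square →
          let (k , ek≡⟨a,b⟩) = mediate ⟨ a , b ⟩ (pairing-equalises square)
          in k , π₁-of ek≡⟨a,b⟩ , π₂-of ek≡⟨a,b⟩
      }
      where open IsWeakEqualiser isWeq

    -- Conversely, for a choice object Y a pointwise factorisation glues to a
    -- genuine one: the leg p₂ of a weak pullback of G and F is surjective,
    -- and its section s gives the factorisation p₁ ∘ s.
    pointwise⇒factor : ∀ {R Y W} {F : Hom Y W} {G : Hom R W} → ChoiceObject Y →
                       PointwiseIn F G → FactorsThrough F G
    pointwise⇒factor {Y = Y} {F = F} {G = G} choiceY pointwise with weakPullback G F
    ... | Q , p₁ , p₂ , isWpb = p₁ ∘ s , factorises
      where
      open IsWeakPullback isWpb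

      p₂-surjective : Surjective p₂
      p₂-surjective y with pointwise y
      ... | u , Gu≡Fy with mediate u y Gu≡Fy
      ...   | m , _ , p₂m≡y = m , p₂m≡y

      section : Σ[ s ∈ Hom Y Q ] p₂ ∘ s ≡ id
      section = choiceY p₂ p₂-surjective

      s : Hom Y Q
      s = proj₁ section

      factorises : G ∘ (p₁ ∘ s) ≡ F
      factorises = begin
        G ∘ (p₁ ∘ s) ≡⟨ sym assoc ⟩
        (G ∘ p₁) ∘ s ≡⟨ cong (_∘ s) commutes ⟩
        (F ∘ p₂) ∘ s ≡⟨ assoc ⟩
        F ∘ (p₂ ∘ s) ≡⟨ cong (F ∘_) (proj₂ section) ⟩
        F ∘ id       ≡⟨ identityʳ ⟩
        F            ∎

    factor⇔pointwise : ∀ {R Y W} {F : Hom Y W} {G : Hom R W} → ChoiceObject Y →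
                       FactorsThrough F G ⇔ PointwiseIn F G
    factor⇔pointwise choiceY = mk⇔ factor⇒pointwise (pointwise⇒factor choiceY)

  module _ {R X : Obj} (r : Hom R (X ⊗ X)) where

    point-related : (u : Hom ⊤ R) → _∼_ r (r₁ r ∘ u) (r₂ r ∘ u)
    point-related u = u , pair-expand r u

    reflexive⇔pointwise : RelReflexive r ⇔ PointwiseIn ⟨ id , id ⟩ r
    reflexive⇔pointwise = mk⇔
      (λ refl-r x → ∈-resp (sym diagonal) (refl-r x))
      (λ pointwise x → ∈-resp diagonal (pointwise x))
      where
      diagonal : ∀ {x : Hom ⊤ X} → ⟨ id , id ⟩ ∘ x ≡ ⟨ x , x ⟩
      diagonal = trans ⟨⟩∘ (cong₂ ⟨_,_⟩ identityˡ identityˡ)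

    symmetric⇔pointwise : RelSymmetric r ⇔ PointwiseIn ⟨ r₂ r , r₁ r ⟩ r
    symmetric⇔pointwise = mk⇔
      (λ sym-r u → ∈-resp (sym ⟨⟩∘) (sym-r _ _ (point-related u)))
      (λ pointwise x x′ (u , ru≡⟨x,x′⟩) →
        ∈-resp (trans ⟨⟩∘ (cong₂ ⟨_,_⟩ (π₂-of ru≡⟨x,x′⟩) (π₁-of ru≡⟨x,x′⟩)))
               (pointwise u))

    -- For a weak pullback (Q, p₁, p₂) of r₂ and r₁, ∼_r is transitive iff
    -- ⟨ r₁ p₁ , r₂ p₂ ⟩ factors through r pointwise: composable pairs of
    -- related points are exactly the global elements of Q.
    transitive⇔pointwise : ∀ {Q} {p₁ p₂ : Hom Q R} → IsWeakPullback C (r₂ r) (r₁ r) p₁ p₂ →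
                           RelTransitive r ⇔ PointwiseIn ⟨ r₁ r ∘ p₁ , r₂ r ∘ p₂ ⟩ r
    transitive⇔pointwise {Q} {p₁} {p₂} isWpb = mk⇔ composite-related from-composites
      where
      open IsWeakPullback isWpb

      composite : ∀ (q : Hom ⊤ Q) →
        ⟨ r₁ r ∘ p₁ , r₂ r ∘ p₂ ⟩ ∘ q ≡ ⟨ r₁ r ∘ (p₁ ∘ q) , r₂ r ∘ (p₂ ∘ q) ⟩
      composite q = trans ⟨⟩∘ (cong₂ ⟨_,_⟩ assoc assoc)

      composite-related : RelTransitive r → PointwiseIn ⟨ r₁ r ∘ p₁ , r₂ r ∘ p₂ ⟩ r
      composite-related trans-r q =
        ∈-resp (sym (composite q))
          (trans-r _ _ _ (point-related (p₁ ∘ q))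
                         (∈-resp (cong₂ ⟨_,_⟩ (sym middle) refl) (point-related (p₂ ∘ q))))
        where
        middle : r₂ r ∘ (p₁ ∘ q) ≡ r₁ r ∘ (p₂ ∘ q)
        middle = trans (sym assoc) (trans (cong (_∘ q) commutes) assoc)

      from-composites : PointwiseIn ⟨ r₁ r ∘ p₁ , r₂ r ∘ p₂ ⟩ r → RelTransitive r
      from-composites pointwise x x′ x″ (u , ru≡⟨x,x′⟩) (v , rv≡⟨x′,x″⟩)
        with mediate u v (trans (π₂-of ru≡⟨x,x′⟩) (sym (π₁-of rv≡⟨x′,x″⟩)))
      ... | m , p₁m≡u , p₂m≡v = ∈-resp endpoints (pointwise m)
        where
        endpoints : ⟨ r₁ r ∘ p₁ , r₂ r ∘ p₂ ⟩ ∘ m ≡ ⟨ x , x″ ⟩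
        endpoints = begin
          ⟨ r₁ r ∘ p₁ , r₂ r ∘ p₂ ⟩ ∘ m         ≡⟨ composite m ⟩
          ⟨ r₁ r ∘ (p₁ ∘ m) , r₂ r ∘ (p₂ ∘ m) ⟩ ≡⟨ cong₂ (λ a b → ⟨ r₁ r ∘ a , r₂ r ∘ b ⟩) p₁m≡u p₂m≡v ⟩
          ⟨ r₁ r ∘ u , r₂ r ∘ v ⟩               ≡⟨ cong₂ ⟨_,_⟩ (π₁-of ru≡⟨x,x′⟩) (π₂-of rv≡⟨x′,x″⟩) ⟩
          ⟨ x , x″ ⟩                            ∎

    module _ (weq : HasWeakEqualisers C) (choice : ∀ (Y : Obj) → ChoiceObject Y) where

      reflexive-arrow⇔relation : IsReflexiveArrow r ⇔ RelReflexive r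
      reflexive-arrow⇔relation =
        ⇔-sym reflexive⇔pointwise ⇔-∘ factor⇔pointwise weq (choice X)

      symmetric-arrow⇔relation : IsSymmetricArrow r ⇔ RelSymmetric r
      symmetric-arrow⇔relation =
        ⇔-sym symmetric⇔pointwise ⇔-∘ factor⇔pointwise weq (choice R)

      transitive-arrow⇔relation : IsTransitiveArrow r ⇔ RelTransitive r
      transitive-arrow⇔relation = mk⇔
        (λ (Q , p₁ , p₂ , isWpb , τ-factor) →
          Equivalence.from (transitive⇔pointwise isWpb)
            (factor⇒pointwise τ-factor))
        (λ trans-r → let (Q , p₁ , p₂ , isWpb) = weakPullback weq (r₂ r) (r₁ r) in
          Q , p₁ , p₂ , isWpb ,
          pointwise⇒factor weq (choice Q)
            (Equivalence.to (transitive⇔pointwise isWpb) trans-r))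

corollary3p10 : ∀ {o ℓ} (C : Category o ℓ) (P : FiniteProducts C) →
    HasWeakEqualisers C →
    (∀ (Y : Category.Obj C) → WithProducts.ChoiceObject C P Y) →
    ∀ {R X : Category.Obj C}
      (r : Category.Hom C R (FiniteProducts._⊗_ P X X)) →
    (WithProducts.IsReflexiveArrow C P r ⇔ WithProducts.RelReflexive C P r)
    × (WithProducts.IsSymmetricArrow C P r ⇔ WithProducts.RelSymmetric C P r)
    × (WithProducts.IsTransitiveArrow C P r ⇔ WithProducts.RelTransitive C P r)
corollary3p10 C P weq choice r =
    reflexive-arrow⇔relation r weq choice
  , symmetric-arrow⇔relation r weq choice
  , transitive-arrow⇔relation r weq choice
  where open Development C P
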